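{- Let $R$ be a transcendental Dedekind domain, and let $\alpha,\beta$ be non-zero elements algebraic over the fraction field of $R$ such that $\alpha/\beta$ is not a root of unity. Assume that $\alpha+\beta\in R$ and $\alpha\beta\in R$, and that the principal ideals $\langle\alpha+\beta\rangle$ and $\langle\alpha\beta\rangle$ of $R$ are coprime ideals which are not both equal to $R$. Define the Lucas sequence $L_n=\frac{\alpha^n-\beta^n}{\alpha-\beta}$, $n\ge1$. Then $(L_n)_{n\ge1}$ is a strong divisibility sequence in $R$: for all positive integers $m,n$, a greatest common divisor $\gcd(L_m,L_n)$ in $R$ and $L_{\gcd(m,n)}$ are associated.
   Context: A Dedekind domain $R$ is called transcendental if it is not a field but contains a field. Two elements of $R$ are associated if one equals the other times a unit of $R$. A greatest common divisor of $a,b\in R$ is a common divisor of $a$ and $b$ that is divisible by every common divisor of $a$ and $b$. A sequence $(a_n)_{n\ge1}$ in $R$ is a strong divisibility sequence if for all positive integers $m,n$, $\gcd(a_m,a_n)$ and $a_d$ are associated, where $d=\gcd(m,n)$. -}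

module Defs where

open import Level using (Level; _⊔_) renaming (suc to lsuc)
open import Data.Nat using (ℕ; zero; suc; _∸_; _≥_)
open import Data.Fin using (Fin; toℕ)
open import Data.Product using (Σ; ∃; ∃-syntax; _×_; _,_)
open import Data.Sum using (_⊎_)
open import Relation.Nullary using (¬_)
open import Algebra.Bundles using (CommutativeRing; CommutativeSemiring)
import Algebra.Definitions.RawSemiring as RS
import Algebra.Morphism.Structures as MS

module Pow {c ℓ : Level} (R : CommutativeRing c ℓ) where
  open RS (CommutativeSemiring.rawSemiring (CommutativeRing.commutativeSemiring R)) public
    using (_^_; sum)

module _ {c ℓ : Level} (R : CommutativeRing c ℓ) where
  open CommutativeRing R
  open Pow R

  Divides : Carrier → Carrier → Set (c ⊔ ℓ)
  Divides a b = ∃[ k ] (b ≈ k * a)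

  IsUnit : Carrier → Set (c ⊔ ℓ)
  IsUnit u = ∃[ v ] (u * v ≈ 1#)

  Associated : Carrier → Carrier → Set (c ⊔ ℓ)
  Associated a b = ∃[ u ] (IsUnit u × a ≈ u * b)

  IsGCD : Carrier → Carrier → Carrier → Set (c ⊔ ℓ)
  IsGCD a b g = Divides g a × Divides g b
              × (∀ d → Divides d a → Divides d b → Divides d g)

  IsIntegralDomain : Set (c ⊔ ℓ)
  IsIntegralDomain = (¬ (1# ≈ 0#)) × (∀ a b → a * b ≈ 0# → (a ≈ 0#) ⊎ (b ≈ 0#))

  IsField : Set (c ⊔ ℓ)
  IsField = (¬ (1# ≈ 0#)) × (∀ x → ¬ (x ≈ 0#) → IsUnit x)

  record Ideal : Set (lsuc (c ⊔ ℓ)) where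
    field
      mem   : Carrier → Set (c ⊔ ℓ)
      resp  : ∀ {x y} → x ≈ y → mem x → mem y
      zero∈ : mem 0#
      +∈    : ∀ {x y} → mem x → mem y → mem (x + y)
      *∈    : ∀ r {x} → mem x → mem (r * x)
  open Ideal public

  _⊆ᴵ_ : Ideal → Ideal → Set (c ⊔ ℓ)
  I ⊆ᴵ J = ∀ x → mem I x → mem J x

  FinitelyGenerated : Ideal → Set (c ⊔ ℓ)
  FinitelyGenerated I =
    ∃[ n ] Σ (Fin n → Carrier) λ g →
      (∀ i → mem I (g i)) ×
      (∀ x → mem I x → Σ (Fin n → Carrier) λ r → (x ≈ sum (λ i → r i * g i)))

  IsNoetherian : Set (lsuc (c ⊔ ℓ))
  IsNoetherian = ∀ (I : Ideal) → FinitelyGenerated I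

  NonzeroIdeal : Ideal → Set (c ⊔ ℓ)
  NonzeroIdeal I = ∃[ x ] (mem I x × ¬ (x ≈ 0#))

  IsPrimeIdeal : Ideal → Set (c ⊔ ℓ)
  IsPrimeIdeal I = (¬ mem I 1#) × (∀ a b → mem I (a * b) → mem I a ⊎ mem I b)

  IsMaximalIdeal : Ideal → Set (lsuc (c ⊔ ℓ))
  IsMaximalIdeal I = (¬ mem I 1#) × (∀ J → I ⊆ᴵ J → (J ⊆ᴵ I) ⊎ mem J 1#)

  DimAtMostOne : Set (lsuc (c ⊔ ℓ))
  DimAtMostOne = ∀ I → NonzeroIdeal I → IsPrimeIdeal I → IsMaximalIdeal I

  -- integrally closed in the fraction field, written out with x = a/b:
  -- if x^n + Σ_{i<n} c_i x^i = 0 (b ≠ 0), then x ∈ R, i.e. b ∣ a.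
  IntegrallyClosed : Set (c ⊔ ℓ)
  IntegrallyClosed =
    ∀ a b → ¬ (b ≈ 0#) → ∀ n (cs : Fin n → Carrier) →
      a ^ n + sum (λ i → cs i * (a ^ toℕ i) * (b ^ (n ∸ toℕ i))) ≈ 0# →
      Divides b a

  IsDedekindDomain : Set (lsuc (c ⊔ ℓ))
  IsDedekindDomain = IsIntegralDomain × IsNoetherian × IntegrallyClosed × DimAtMostOne

  ContainsField : Set (lsuc (c ⊔ ℓ))
  ContainsField =
    Σ (Carrier → Set (c ⊔ ℓ)) λ F →
      (∀ {x y} → x ≈ y → F x → F y) × F 0# × F 1#
      × (∀ {x y} → F x → F y → F (x + y))
      × (∀ {x} → F x → F (- x))
      × (∀ {x y} → F x → F y → F (x * y))
      × (∀ {x} → F x → ¬ (x ≈ 0#) → ∃[ y ] (F y × x * y ≈ 1#))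

  IsTranscendentalDedekind : Set (lsuc (c ⊔ ℓ))
  IsTranscendentalDedekind = IsDedekindDomain × (¬ IsField) × ContainsField

  IsRootOfUnity : Carrier → Set ℓ
  IsRootOfUnity z = ∃[ n ] (n ≥ 1 × z ^ n ≈ 1#)

IsRingEmbedding : ∀ {c ℓ c' ℓ'} (R : CommutativeRing c ℓ) (L : CommutativeRing c' ℓ') →
                  (CommutativeRing.Carrier R → CommutativeRing.Carrier L) → Set (c ⊔ ℓ ⊔ ℓ')
IsRingEmbedding R L ι =
  MS.RingMorphisms.IsRingMonomorphism (CommutativeRing.rawRing R) (CommutativeRing.rawRing L) ι

-- α ∈ L is algebraic over the fraction field of R (embedded via ι); after
-- clearing denominators: α is a root of a nonzero polynomial with coefficients in R
IsAlgebraicOver : ∀ {c ℓ c' ℓ'} (R : CommutativeRing c ℓ) (L : CommutativeRing c' ℓ') →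
                  (CommutativeRing.Carrier R → CommutativeRing.Carrier L) →
                  CommutativeRing.Carrier L → Set (c ⊔ ℓ ⊔ ℓ')
IsAlgebraicOver R L ι α =
  ∃[ n ] Σ (Fin (suc n) → R.Carrier) λ cs →
    (∃[ i ] ¬ (cs i R.≈ R.0#)) ×
    (LS.sum (λ i → ι (cs i) L.* (α LS.^ toℕ i)) L.≈ L.0#)
  where
    module R = CommutativeRing R
    module L = CommutativeRing L
    module LS = Pow L

module Submission where

-- Let u be the Lucas sequence of (p, q) in a commutative ring R:
-- u 0 = 0, u 1 = 1, u (n + 2) = p · u (n + 1) − q · u n.  If p and q are
-- comaximal, then for all m, n the ideal ⟨u m, u n⟩ is the principal ideal
-- ⟨u (gcd m n)⟩, i.e. u (gcd m n) is a common divisor of u m and u n that is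
-- an R-linear combination of them.  This is proved by running the
-- subtractive Euclidean algorithm on the indices: the addition formula
--   u (n + k) = u (k + 1) · u n − (q · u (n − 1)) · u k
-- together with the comaximality of u n and q · u (n − 1) shows that
-- ⟨u n, u (n + k)⟩ = ⟨u n, u k⟩.  Such a generator is a gcd in the sense of
-- divisibility, and in a domain any two nonzero gcds are associated.
--
-- To reach the theorem, the given sequence l (defined by l n · (α − β) =
-- αⁿ − βⁿ in a field containing R) is identified with u through Binet's
-- formula ι (u n) · (α − β) = αⁿ − βⁿ; the hypothesis that α/β is not a root
-- of unity gives α − β ≠ 0 and u d ≠ 0 for d ≥ 1.

open import Defs
open import Level using (Level; _⊔_)
open import Algebra.Bundles using (CommutativeRing; RawRing)
open import Algebra.Morphism.Structures using (module RingMorphisms)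
open import Data.Nat as ℕ using (ℕ; zero; suc; _∸_; _≤_; _≥_; s≤s; s≤s⁻¹)
import Data.Nat.Properties as ℕP
open import Data.Nat.GCD using (gcd; gcd-GCD; gcd-comm; gcd-identityˡ; gcd[m,n]≢0; module GCD)
open import Data.Product using (_×_; _,_; ∃-syntax; proj₂)
open import Data.Maybe using (Maybe; just; nothing)
open import Data.Sum using (inj₁; inj₂)
open import Data.Empty using (⊥-elim)
open import Relation.Nullary using (¬_; yes; no)
import Relation.Binary.PropositionalEquality as P

-- The library solver needs
-- a coefficient ring with a (semi-)decision procedure for equality; we use
-- formal differences (a , b) of natural numbers, interpreted as
-- (a ∸ b)·1 − (b ∸ a)·1, so that integer coefficients can cancel.
module RingSolver {c ℓ} (R : CommutativeRing c ℓ) where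
  open CommutativeRing R
  open import Algebra.Properties.Semiring.Mult semiring using (×-homo-+; ×1-homo-*) renaming (_×_ to _·_)
  open import Algebra.Properties.Ring ring using (-‿distribˡ-*; -‿distribʳ-*)
  open import Algebra.Properties.AbelianGroup +-abelianGroup using (⁻¹-∙-comm)
  open import Algebra.Properties.Group +-group using (⁻¹-involutive; ε⁻¹≈ε)
  import Algebra.Solver.CommutativeMonoid +-commutativeMonoid as CM
  open CM using (_⊕_; _⊜_)
  import Algebra.Solver.Ring.AlmostCommutativeRing as ACR
  open import Relation.Binary.Reasoning.Setoid setoid

  Coefficient : RawRing _ _
  Coefficient = record
    { Carrier = ℕ × ℕ
    ; _≈_ = P._≡_
    ; _+_ = λ { (a , b) (c , d) → (a ℕ.+ c , b ℕ.+ d) }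
    ; _*_ = λ { (a , b) (c , d) → (a ℕ.* c ℕ.+ b ℕ.* d , a ℕ.* d ℕ.+ b ℕ.* c) }
    ; -_ = λ { (a , b) → (b , a) }
    ; 0# = (0 , 0)
    ; 1# = (1 , 0)
    }
  open RawRing Coefficient using () renaming (_+_ to _+ᶜ_; _*_ to _*ᶜ_; -_ to -ᶜ_)

  N : ℕ → Carrier
  N n = n · 1#

  ⟦_⟧ᶜ : ℕ × ℕ → Carrier
  ⟦ (a , b) ⟧ᶜ = N (a ∸ b) - N (b ∸ a)

  neg-+ : ∀ x y → - (x + y) ≈ - x + - y
  neg-+ x y = sym (⁻¹-∙-comm x y)

  sub-+ : ∀ x y z w → (x + z) - (y + w) ≈ (x - y) + (z - w)
  sub-+ x y z w = begin
    (x + z) - (y + w)     ≈⟨ +-congˡ (neg-+ y w) ⟩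
    (x + z) + (- y + - w) ≈⟨ CM.solve 4 (λ a b c d → (a ⊕ b) ⊕ (c ⊕ d) ⊜ (a ⊕ c) ⊕ (b ⊕ d)) refl x z (- y) (- w) ⟩
    (x - y) + (z - w)     ∎

  ⟦⟧ᶜ-difference : ∀ a b → ⟦ (a , b) ⟧ᶜ ≈ N a - N b
  ⟦⟧ᶜ-difference zero    zero    = refl
  ⟦⟧ᶜ-difference zero    (suc b) = refl
  ⟦⟧ᶜ-difference (suc a) zero    = refl
  ⟦⟧ᶜ-difference (suc a) (suc b) = begin
    ⟦ (a , b) ⟧ᶜ              ≈⟨ ⟦⟧ᶜ-difference a b ⟩
    N a - N b                 ≈⟨ +-identityˡ _ ⟨
    0# + (N a - N b)          ≈⟨ +-congʳ (-‿inverseʳ 1#) ⟨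
    (1# - 1#) + (N a - N b)   ≈⟨ sub-+ 1# 1# (N a) (N b) ⟨
    N (suc a) - N (suc b)     ∎

  mul-sub : ∀ x y z w → (x - y) * (z - w) ≈ (x * z + y * w) - (x * w + y * z)
  mul-sub x y z w = begin
    (x - y) * (z - w)                                 ≈⟨ distribʳ (z - w) x (- y) ⟩
    x * (z - w) + (- y) * (z - w)                     ≈⟨ +-cong (distribˡ x z (- w)) (distribˡ (- y) z (- w)) ⟩
    (x * z + x * (- w)) + ((- y) * z + (- y) * (- w)) ≈⟨ +-cong (+-congˡ (sym (-‿distribʳ-* x w))) (+-cong (sym (-‿distribˡ-* y z)) neg-neg) ⟩
    (x * z + - (x * w)) + (- (y * z) + y * w)         ≈⟨ CM.solve 4 (λ a b c d → (a ⊕ b) ⊕ (c ⊕ d) ⊜ (a ⊕ d) ⊕ (b ⊕ c)) refl (x * z) (- (x * w)) (- (y * z)) (y * w) ⟩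
    (x * z + y * w) + (- (x * w) + - (y * z))         ≈⟨ +-congˡ (neg-+ (x * w) (y * z)) ⟨
    (x * z + y * w) - (x * w + y * z)                 ∎
    where
    neg-neg : (- y) * (- w) ≈ y * w
    neg-neg = trans (sym (-‿distribˡ-* y (- w))) (trans (-‿cong (sym (-‿distribʳ-* y w))) (⁻¹-involutive (y * w)))

  +-homo : ∀ x y → ⟦ x +ᶜ y ⟧ᶜ ≈ ⟦ x ⟧ᶜ + ⟦ y ⟧ᶜ
  +-homo (a , b) (c , d) = begin
    ⟦ (a ℕ.+ c , b ℕ.+ d) ⟧ᶜ   ≈⟨ ⟦⟧ᶜ-difference (a ℕ.+ c) (b ℕ.+ d) ⟩
    N (a ℕ.+ c) - N (b ℕ.+ d)   ≈⟨ +-cong (×-homo-+ 1# a c) (-‿cong (×-homo-+ 1# b d)) ⟩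
    (N a + N c) - (N b + N d)   ≈⟨ sub-+ (N a) (N b) (N c) (N d) ⟩
    (N a - N b) + (N c - N d)   ≈⟨ +-cong (⟦⟧ᶜ-difference a b) (⟦⟧ᶜ-difference c d) ⟨
    ⟦ (a , b) ⟧ᶜ + ⟦ (c , d) ⟧ᶜ ∎

  *-homo : ∀ x y → ⟦ x *ᶜ y ⟧ᶜ ≈ ⟦ x ⟧ᶜ * ⟦ y ⟧ᶜ
  *-homo (a , b) (c , d) = begin
    ⟦ (a ℕ.* c ℕ.+ b ℕ.* d , a ℕ.* d ℕ.+ b ℕ.* c) ⟧ᶜ     ≈⟨ ⟦⟧ᶜ-difference (a ℕ.* c ℕ.+ b ℕ.* d) (a ℕ.* d ℕ.+ b ℕ.* c) ⟩
    N (a ℕ.* c ℕ.+ b ℕ.* d) - N (a ℕ.* d ℕ.+ b ℕ.* c)   ≈⟨ +-cong (N-+* a c b d) (-‿cong (N-+* a d b c)) ⟩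
    (N a * N c + N b * N d) - (N a * N d + N b * N c)   ≈⟨ mul-sub (N a) (N b) (N c) (N d) ⟨
    (N a - N b) * (N c - N d)                           ≈⟨ *-cong (⟦⟧ᶜ-difference a b) (⟦⟧ᶜ-difference c d) ⟨
    ⟦ (a , b) ⟧ᶜ * ⟦ (c , d) ⟧ᶜ                         ∎
    where
    N-+* : ∀ a c b d → N (a ℕ.* c ℕ.+ b ℕ.* d) ≈ N a * N c + N b * N d
    N-+* a c b d = trans (×-homo-+ 1# (a ℕ.* c) (b ℕ.* d)) (+-cong (×1-homo-* a c) (×1-homo-* b d))

  -‿homo : ∀ x → ⟦ -ᶜ x ⟧ᶜ ≈ - ⟦ x ⟧ᶜ
  -‿homo (a , b) = begin
    ⟦ (b , a) ⟧ᶜ      ≈⟨ ⟦⟧ᶜ-difference b a ⟩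
    N b - N a         ≈⟨ +-comm (N b) (- N a) ⟩
    - N a + N b       ≈⟨ +-congˡ (⁻¹-involutive (N b)) ⟨
    - N a + - - N b   ≈⟨ neg-+ (N a) (- N b) ⟨
    - (N a - N b)     ≈⟨ -‿cong (⟦⟧ᶜ-difference a b) ⟨
    - ⟦ (a , b) ⟧ᶜ    ∎

  morphism : Coefficient ACR.-Raw-AlmostCommutative⟶ ACR.fromCommutativeRing R
  morphism = record
    { ⟦_⟧ = ⟦_⟧ᶜ
    ; +-homo = +-homo
    ; *-homo = *-homo
    ; -‿homo = -‿homo
    ; 0-homo = -‿inverseʳ 0#
    ; 1-homo = trans (+-cong (+-identityʳ 1#) ε⁻¹≈ε) (+-identityʳ 1#)
    }

  equal? : ∀ x y → Maybe (⟦ x ⟧ᶜ ≈ ⟦ y ⟧ᶜ)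
  equal? (a , b) (c , d) with (a ∸ b) ℕ.≟ (c ∸ d) | (b ∸ a) ℕ.≟ (d ∸ c)
  ... | yes e₁ | yes e₂ = just (+-cong (reflexive (P.cong N e₁)) (-‿cong (reflexive (P.cong N e₂))))
  ... | _      | _      = nothing

  open import Algebra.Solver.Ring Coefficient (ACR.fromCommutativeRing R) morphism equal? public

module Divisibility {c ℓ} (R : CommutativeRing c ℓ) where
  open CommutativeRing R
  open RingSolver R using (solve; _:=_; _:+_; _:*_; :-_; _:-_)
  open import Relation.Binary.Reasoning.Setoid setoid

  Comaximal : Carrier → Carrier → Set (c ⊔ ℓ)
  Comaximal a b = ∃[ x ] ∃[ y ] (x * a + y * b ≈ 1#)

  IsCombination : Carrier → Carrier → Carrier → Set (c ⊔ ℓ)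
  IsCombination a b g = ∃[ x ] ∃[ y ] (g ≈ x * a + y * b)

  IsBezoutGCD : Carrier → Carrier → Carrier → Set (c ⊔ ℓ)
  IsBezoutGCD a b g = IsCombination a b g × Divides R g a × Divides R g b

  divides-resp : ∀ {a a′ b b′} → a ≈ a′ → b ≈ b′ → Divides R a b → Divides R a′ b′
  divides-resp a≈a′ b≈b′ (k , b≈ka) = k , trans (sym b≈b′) (trans b≈ka (*-congˡ a≈a′))

  divides-combination : ∀ {d a b} x y → Divides R d a → Divides R d b → Divides R d (x * a + y * b)
  divides-combination {d} {a} {b} x y (k , a≈kd) (k′ , b≈k′d) = x * k + y * k′ , (begin
    x * a + y * b               ≈⟨ +-cong (*-congˡ a≈kd) (*-congˡ b≈k′d) ⟩
    x * (k * d) + y * (k′ * d)  ≈⟨ solve 5 (λ x k y k′ d → x :* (k :* d) :+ y :* (k′ :* d) := (x :* k :+ y :* k′) :* d) refl x k y k′ d ⟩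
    (x * k + y * k′) * d        ∎)

  comaximal-sym : ∀ {a b} → Comaximal a b → Comaximal b a
  comaximal-sym (x , y , e) = y , x , trans (+-comm _ _) e

  comaximal-one : ∀ a → Comaximal a 1#
  comaximal-one a = 0# , 1# , trans (+-cong (zeroˡ a) (*-identityˡ 1#)) (+-identityˡ 1#)

  comaximal-* : ∀ {a b c} → Comaximal a b → Comaximal a c → Comaximal a (b * c)
  comaximal-* {a} {b} {c} (x , y , e) (x′ , y′ , e′) = x * x′ * a + x * y′ * c + y * x′ * b , y * y′ , (begin
    (x * x′ * a + x * y′ * c + y * x′ * b) * a + y * y′ * (b * c)
      ≈⟨ solve 7 (λ x x′ y y′ a b c → (x :* x′ :* a :+ x :* y′ :* c :+ y :* x′ :* b) :* a :+ y :* y′ :* (b :* c)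
                                     := (x :* a :+ y :* b) :* (x′ :* a :+ y′ :* c)) refl x x′ y y′ a b c ⟩
    (x * a + y * b) * (x′ * a + y′ * c) ≈⟨ *-cong e e′ ⟩
    1# * 1#                             ≈⟨ *-identityʳ 1# ⟩
    1#                                  ∎)

  comaximal-sub : ∀ {a b} → Comaximal a b → ∀ k → Comaximal a (b - a * k)
  comaximal-sub {a} {b} (x , y , e) k = x + y * k , y , trans
    (solve 5 (λ x y k a b → (x :+ y :* k) :* a :+ y :* (b :- a :* k) := x :* a :+ y :* b) refl x y k a b) e

  comaximal-sub′ : ∀ {a b} → Comaximal a b → ∀ k → Comaximal a (k * a - b)
  comaximal-sub′ {a} {b} (x , y , e) k = x + y * k , - y , trans
    (solve 5 (λ x y k a b → (x :+ y :* k) :* a :+ (:- y) :* (k :* a :- b) := x :* a :+ y :* b) refl x y k a b) e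

  bezoutGCD-resp : ∀ {a a′ b b′ g g′} → a ≈ a′ → b ≈ b′ → g ≈ g′ → IsBezoutGCD a b g → IsBezoutGCD a′ b′ g′
  bezoutGCD-resp a≈a′ b≈b′ g≈g′ ((x , y , g≈) , g∣a , g∣b) =
    (x , y , trans (sym g≈g′) (trans g≈ (+-cong (*-congˡ a≈a′) (*-congˡ b≈b′))))
    , divides-resp g≈g′ a≈a′ g∣a , divides-resp g≈g′ b≈b′ g∣b

  bezoutGCD-sym : ∀ {a b g} → IsBezoutGCD a b g → IsBezoutGCD b a g
  bezoutGCD-sym ((x , y , g≈) , g∣a , g∣b) = (y , x , trans g≈ (+-comm _ _)) , g∣b , g∣a

  bezoutGCD-zero : ∀ b → IsBezoutGCD 0# b b
  bezoutGCD-zero b = (0# , 1# , sym (trans (+-cong (zeroˡ 0#) (*-identityˡ b)) (+-identityˡ b)))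
                   , (0# , sym (zeroˡ b)) , (1# , sym (*-identityˡ b))

  bezoutGCD-step : ∀ {a c x g} → Comaximal a c → ∀ A → IsBezoutGCD a x g → IsBezoutGCD a (A * a - c * x) g
  bezoutGCD-step {a} {c} {x} {g} (s , t , sa+tc≈1) A ((X , Y , g≈) , g∣a , g∣x) =
    (X + Y * x * s + Y * t * A , - (Y * t) , combination) , g∣a , divides-new
    where
    divides-new : Divides R g (A * a - c * x)
    divides-new = divides-resp refl (+-congˡ (sym (-‿distribˡ-* c x))) (divides-combination A (- c) g∣a g∣x)
      where open import Algebra.Properties.Ring ring using (-‿distribˡ-*)
    combination : g ≈ (X + Y * x * s + Y * t * A) * a + - (Y * t) * (A * a - c * x)
    combination = begin
      g                               ≈⟨ g≈ ⟩
      X * a + Y * x                   ≈⟨ +-congˡ (*-identityʳ _) ⟨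
      X * a + Y * x * 1#              ≈⟨ +-congˡ (*-congˡ sa+tc≈1) ⟨
      X * a + Y * x * (s * a + t * c)
        ≈⟨ solve 8 (λ X Y x s t A a c → X :* a :+ Y :* x :* (s :* a :+ t :* c)
                    := (X :+ Y :* x :* s :+ Y :* t :* A) :* a :+ (:- (Y :* t)) :* (A :* a :- c :* x)) refl X Y x s t A a c ⟩
      (X + Y * x * s + Y * t * A) * a + - (Y * t) * (A * a - c * x) ∎

  bezoutGCD⇒isGCD : ∀ {a b g} → IsBezoutGCD a b g → IsGCD R a b g
  bezoutGCD⇒isGCD ((x , y , g≈) , g∣a , g∣b) =
    g∣a , g∣b , λ d d∣a d∣b → divides-resp refl (sym g≈) (divides-combination x y d∣a d∣b)

  mutual-divisors-associated : IsIntegralDomain R → ∀ {a b} → ¬ b ≈ 0# →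
                               Divides R a b → Divides R b a → Associated R a b
  mutual-divisors-associated (_ , no-zero-divisors) {a} {b} b≉0 (k , b≈ka) (k′ , a≈k′b)
    with no-zero-divisors (k * k′ - 1#) b kk′-1·b≈0
    where
    open import Algebra.Properties.Ring ring using ([y-z]x≈yx-zx)
    kk′-1·b≈0 : (k * k′ - 1#) * b ≈ 0#
    kk′-1·b≈0 = begin
      (k * k′ - 1#) * b     ≈⟨ [y-z]x≈yx-zx b (k * k′) 1# ⟩
      k * k′ * b - 1# * b   ≈⟨ +-cong (trans (*-assoc k k′ b) (trans (*-congˡ (sym a≈k′b)) (sym b≈ka))) (-‿cong (*-identityˡ b)) ⟩
      b - b                 ≈⟨ -‿inverseʳ b ⟩
      0#                    ∎
  ... | inj₁ kk′-1≈0 = k′ , (k , trans (*-comm k′ k) (x∙y⁻¹≈ε⇒x≈y _ _ kk′-1≈0)) , a≈k′b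
    where open import Algebra.Properties.Group +-group using (x∙y⁻¹≈ε⇒x≈y)
  ... | inj₂ b≈0 = ⊥-elim (b≉0 b≈0)

  isGCD-associated : IsIntegralDomain R → ∀ {a b g g′} → ¬ g′ ≈ 0# →
                     IsGCD R a b g → IsGCD R a b g′ → Associated R g g′
  isGCD-associated domain g′≉0 (g∣a , g∣b , g-greatest) (g′∣a , g′∣b , g′-greatest) =
    mutual-divisors-associated domain g′≉0 (g′-greatest _ g∣a g∣b) (g-greatest _ g′∣a g′∣b)

-- Induction along the subtractive Euclidean algorithm: a relation on ℕ that
-- holds on (0 , n), is symmetric and passes from (n , k) to (n , n + k)
-- holds everywhere.  (Recursion on a bound for m + n.)
euclid-induction : ∀ {a} (Rel : ℕ → ℕ → Set a) →
                   (∀ n → Rel 0 n) →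
                   (∀ m n → Rel m n → Rel n m) →
                   (∀ n k → Rel n k → Rel n (n ℕ.+ k)) →
                   ∀ m n → Rel m n
euclid-induction Rel base sym step m n = bounded (m ℕ.+ n) m n ℕP.≤-refl
  where
  bounded : ∀ s m n → m ℕ.+ n ≤ s → Rel m n
  smaller-first : ∀ s {a b} → a ≤ b → suc a ℕ.+ suc b ≤ suc s → Rel (suc a) (suc b)

  bounded _       zero    n       _     = base n
  bounded _       (suc m) zero    _     = sym 0 (suc m) (base (suc m))
  bounded (suc s) (suc m) (suc n) bound with ℕP.≤-total m n
  ... | inj₁ m≤n = smaller-first s m≤n bound
  ... | inj₂ n≤m = sym (suc n) (suc m) (smaller-first s n≤m (P.subst (_≤ suc s) (ℕP.+-comm (suc m) (suc n)) bound))

  smaller-first s {a} {b} a≤b bound with ℕP.m≤n⇒∃[o]m+o≡n a≤b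
  ... | o , a+o≡b = P.subst (Rel (suc a)) (P.cong suc a+o≡b)
                      (step (suc a) o (bounded s (suc a) o (P.subst (_≤ s) (P.sym (P.cong suc a+o≡b)) suc-b≤s)))
    where
    suc-b≤s : suc b ≤ s
    suc-b≤s = ℕP.m+n≤o⇒n≤o a (s≤s⁻¹ bound)

module Lucas {c ℓ} (R : CommutativeRing c ℓ) (p q : CommutativeRing.Carrier R) where
  open CommutativeRing R
  open RingSolver R using (solve; _:=_; _:+_; _:*_; :-_; _:-_)
  open Divisibility R
  open import Relation.Binary.Reasoning.Setoid setoid

  u : ℕ → Carrier
  u zero          = 0#
  u (suc zero)    = 1#
  u (suc (suc n)) = p * u (suc n) - q * u n

  u-two : u 2 ≈ p
  u-two = trans (+-cong (*-identityʳ p) (trans (-‿cong (zeroʳ q)) -0#≈0#)) (+-identityʳ p)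
    where open import Algebra.Properties.Ring ring using (-0#≈0#)

  u-addition : ∀ m n → u (suc m ℕ.+ n) ≈ u (suc n) * u (suc m) - q * u m * u n
  u-addition zero n = begin
    u (suc n)                         ≈⟨ +-identityʳ _ ⟨
    u (suc n) + 0#                    ≈⟨ +-cong (*-identityʳ _) (trans (-‿cong q·0·x≈0) -0#≈0#) ⟨
    u (suc n) * 1# - q * 0# * u n     ∎
    where
    open import Algebra.Properties.Ring ring using (-0#≈0#)
    q·0·x≈0 : q * 0# * u n ≈ 0#
    q·0·x≈0 = trans (*-congʳ (zeroʳ q)) (zeroˡ (u n))
  u-addition (suc zero) n = begin
    p * u (suc n) - q * u n           ≈⟨ +-cong (*-comm _ p) (-‿cong (*-congʳ (*-identityʳ q))) ⟨
    u (suc n) * p - q * 1# * u n      ≈⟨ +-congʳ (*-congˡ u-two) ⟨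
    u (suc n) * u 2 - q * 1# * u n    ∎
  u-addition (suc (suc m)) n = begin
    p * u (suc (suc m) ℕ.+ n) - q * u (suc m ℕ.+ n)
      ≈⟨ +-cong (*-congˡ (u-addition (suc m) n)) (-‿cong (*-congˡ (u-addition m n))) ⟩
    p * (A * u₂ - q * u₁ * B) - q * (A * u₁ - q * u₀ * B)
      ≈⟨ solve 7 (λ p q A B u₂ u₁ u₀ → p :* (A :* u₂ :- q :* u₁ :* B) :- q :* (A :* u₁ :- q :* u₀ :* B)
                  := A :* (p :* u₂ :- q :* u₁) :- q :* (p :* u₁ :- q :* u₀) :* B) refl p q A B u₂ u₁ u₀ ⟩
    A * (p * u₂ - q * u₁) - q * (p * u₁ - q * u₀) * B ∎
    where
    A = u (suc n)
    B = u n
    u₂ = u (suc (suc m))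
    u₁ = u (suc m)
    u₀ = u m

  module _ (p⊥q : Comaximal p q) where

    -- u (n + 1) is a unit modulo q, since u (n + 2) ≡ p · u (n + 1) (mod q)
    q⊥u : ∀ n → Comaximal q (u (suc n))
    q⊥u zero    = comaximal-one q
    q⊥u (suc n) = comaximal-sub (comaximal-* (comaximal-sym p⊥q) (q⊥u n)) (u n)

    -- u (n + 1) is coprime to q · u n; in particular consecutive terms are
    -- coprime, since u (n + 2) ≡ − q · u n (mod u (n + 1))
    u⊥q·u : ∀ n → Comaximal (u (suc n)) (q * u n)
    u⊥q·u zero    = comaximal-sym (comaximal-one (q * 0#))
    u⊥q·u (suc n) = comaximal-* (comaximal-sym (q⊥u (suc n))) (comaximal-sym (comaximal-sub′ (u⊥q·u n) p))

    u-euclid-step : ∀ {n k g} → IsBezoutGCD (u n) (u k) g → IsBezoutGCD (u n) (u (n ℕ.+ k)) g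
    u-euclid-step {zero}  h = h
    u-euclid-step {suc m} {k} h =
      bezoutGCD-resp refl (sym (u-addition m k)) refl (bezoutGCD-step (u⊥q·u m) (u (suc k)) h)

    u-strong-divisibility : ∀ m n → IsBezoutGCD (u m) (u n) (u (gcd m n))
    u-strong-divisibility = euclid-induction (λ m n → IsBezoutGCD (u m) (u n) (u (gcd m n)))
                                             zero-case swap-case step-case
      where
      zero-case : ∀ n → IsBezoutGCD (u 0) (u n) (u (gcd 0 n))
      zero-case n = P.subst (λ g → IsBezoutGCD 0# (u n) (u g)) (P.sym (gcd-identityˡ n)) (bezoutGCD-zero (u n))

      swap-case : ∀ m n → IsBezoutGCD (u m) (u n) (u (gcd m n)) → IsBezoutGCD (u n) (u m) (u (gcd n m))
      swap-case m n h = P.subst (λ g → IsBezoutGCD (u n) (u m) (u g)) (gcd-comm m n) (bezoutGCD-sym h)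

      gcd-step : ∀ n k → gcd n (n ℕ.+ k) P.≡ gcd n k
      gcd-step n k = GCD.unique (gcd-GCD n (n ℕ.+ k)) (GCD.step (gcd-GCD n k))

      step-case : ∀ n k → IsBezoutGCD (u n) (u k) (u (gcd n k)) →
                  IsBezoutGCD (u n) (u (n ℕ.+ k)) (u (gcd n (n ℕ.+ k)))
      step-case n k h = P.subst (λ g → IsBezoutGCD (u n) (u (n ℕ.+ k)) (u g)) (P.sym (gcd-step n k)) (u-euclid-step {n} {k} h)

module FieldFacts {c ℓ} (L : CommutativeRing c ℓ) (isField : IsField L) where
  open CommutativeRing L
  open Pow L using (_^_)
  open import Algebra.Properties.CommutativeSemiring.Exp commutativeSemiring using (^-distrib-*; ^-congˡ)
  open import Algebra.Properties.Monoid.Mult *-monoid using (×-idem)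
  open import Relation.Binary.Reasoning.Setoid setoid

  *-cancelʳ : ∀ {x y d} → ¬ d ≈ 0# → x * d ≈ y * d → x ≈ y
  *-cancelʳ {x} {y} {d} d≉0 xd≈yd with proj₂ isField d d≉0
  ... | w , dw≈1 = begin
    x             ≈⟨ *-identityʳ x ⟨
    x * 1#        ≈⟨ *-congˡ dw≈1 ⟨
    x * (d * w)   ≈⟨ *-assoc x d w ⟨
    (x * d) * w   ≈⟨ *-congʳ xd≈yd ⟩
    (y * d) * w   ≈⟨ *-assoc y d w ⟩
    y * (d * w)   ≈⟨ *-congˡ dw≈1 ⟩
    y * 1#        ≈⟨ *-identityʳ y ⟩
    y             ∎

  equal-powers⇒root-of-unity : ∀ {α β} d → d ≥ 1 → ¬ β ≈ 0# → α ^ d ≈ β ^ d →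
                               ∃[ γ ] (β * γ ≈ α × IsRootOfUnity L γ)
  equal-powers⇒root-of-unity {α} {β} d d≥1 β≉0 αᵈ≈βᵈ with proj₂ isField β β≉0
  ... | w , βw≈1 = α * w , βγ≈α , d , d≥1 , γᵈ≈1
    where
    βγ≈α : β * (α * w) ≈ α
    βγ≈α = begin
      β * (α * w)   ≈⟨ *-assoc β α w ⟨
      (β * α) * w   ≈⟨ *-congʳ (*-comm β α) ⟩
      (α * β) * w   ≈⟨ *-assoc α β w ⟩
      α * (β * w)   ≈⟨ *-congˡ βw≈1 ⟩
      α * 1#        ≈⟨ *-identityʳ α ⟩
      α             ∎
    γᵈ≈1 : (α * w) ^ d ≈ 1#
    γᵈ≈1 = begin
      (α * w) ^ d   ≈⟨ ^-distrib-* α w d ⟩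
      α ^ d * w ^ d ≈⟨ *-congʳ αᵈ≈βᵈ ⟩
      β ^ d * w ^ d ≈⟨ ^-distrib-* β w d ⟨
      (β * w) ^ d   ≈⟨ ^-congˡ d βw≈1 ⟩
      1# ^ d        ≈⟨ ×-idem (*-identityʳ 1#) d {{ℕ.>-nonZero d≥1}} ⟩
      1#            ∎

module Binet {c ℓ c′ ℓ′} (R : CommutativeRing c ℓ) (L : CommutativeRing c′ ℓ′)
  (ι : CommutativeRing.Carrier R → CommutativeRing.Carrier L)
  (ι-homo : RingMorphisms.IsRingHomomorphism (CommutativeRing.rawRing R) (CommutativeRing.rawRing L) ι)
  (p q : CommutativeRing.Carrier R) (α β : CommutativeRing.Carrier L)
  (ι[p] : CommutativeRing._≈_ L (ι p) (CommutativeRing._+_ L α β))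
  (ι[q] : CommutativeRing._≈_ L (ι q) (CommutativeRing._*_ L α β))
  where
  private module R = CommutativeRing R
  open CommutativeRing L
  open RingMorphisms.IsRingHomomorphism ι-homo
  open RingSolver L using (solve; _:=_; _:+_; _:*_; :-_; _:-_)
  open Lucas R p q using (u)
  open Pow L using (_^_)
  open import Relation.Binary.Reasoning.Setoid setoid

  ι-recurrence : ∀ n → ι (u (suc (suc n))) ≈ (α + β) * ι (u (suc n)) - (α * β) * ι (u n)
  ι-recurrence n = begin
    ι (p R.* u (suc n) R.- q R.* u n)         ≈⟨ +-homo _ _ ⟩
    ι (p R.* u (suc n)) + ι (R.- (q R.* u n)) ≈⟨ +-cong (*-homo p _) (trans (-‿homo _) (-‿cong (*-homo q _))) ⟩
    ι p * ι (u (suc n)) - ι q * ι (u n)       ≈⟨ +-cong (*-congʳ ι[p]) (-‿cong (*-congʳ ι[q])) ⟩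
    (α + β) * ι (u (suc n)) - (α * β) * ι (u n) ∎

  binet : ∀ n → ι (u n) * (α - β) ≈ α ^ n - β ^ n
  binet zero = begin
    ι R.0# * (α - β) ≈⟨ *-congʳ 0#-homo ⟩
    0# * (α - β)     ≈⟨ zeroˡ _ ⟩
    0#               ≈⟨ -‿inverseʳ 1# ⟨
    1# - 1#          ∎
  binet (suc zero) = begin
    ι R.1# * (α - β)       ≈⟨ *-congʳ 1#-homo ⟩
    1# * (α - β)           ≈⟨ *-identityˡ _ ⟩
    α - β                  ≈⟨ +-cong (*-identityʳ α) (-‿cong (*-identityʳ β)) ⟨
    α * 1# - β * 1#        ∎
  binet (suc (suc n)) = begin
    ι (u (suc (suc n))) * (α - β)
      ≈⟨ *-congʳ (ι-recurrence n) ⟩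
    ((α + β) * U₁ - (α * β) * U₀) * (α - β)
      ≈⟨ solve 4 (λ a b U₁ U₀ → ((a :+ b) :* U₁ :- (a :* b) :* U₀) :* (a :- b)
                  := (a :+ b) :* (U₁ :* (a :- b)) :- (a :* b) :* (U₀ :* (a :- b))) refl α β U₁ U₀ ⟩
    (α + β) * (U₁ * (α - β)) - (α * β) * (U₀ * (α - β))
      ≈⟨ +-cong (*-congˡ (binet (suc n))) (-‿cong (*-congˡ (binet n))) ⟩
    (α + β) * (α * α ^ n - β * β ^ n) - (α * β) * (α ^ n - β ^ n)
      ≈⟨ solve 4 (λ a b A B → (a :+ b) :* (a :* A :- b :* B) :- (a :* b) :* (A :- B)
                  := a :* (a :* A) :- b :* (b :* B)) refl α β (α ^ n) (β ^ n) ⟩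
    α ^ suc (suc n) - β ^ suc (suc n) ∎
    where
    U₁ = ι (u (suc n))
    U₀ = ι (u n)

module LucasInField {c ℓ c′ ℓ′} (R : CommutativeRing c ℓ) (L : CommutativeRing c′ ℓ′)
  (isField : IsField L)
  (ι : CommutativeRing.Carrier R → CommutativeRing.Carrier L) (ι-mono : IsRingEmbedding R L ι)
  (α β : CommutativeRing.Carrier L)
  (β≉0 : ¬ CommutativeRing._≈_ L β (CommutativeRing.0# L))
  (α/β-not-root : ∀ γ → CommutativeRing._≈_ L (CommutativeRing._*_ L β γ) α → ¬ IsRootOfUnity L γ)
  (p q : CommutativeRing.Carrier R)
  (ι[p] : CommutativeRing._≈_ L (ι p) (CommutativeRing._+_ L α β))
  (ι[q] : CommutativeRing._≈_ L (ι q) (CommutativeRing._*_ L α β))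
  where
  private module R = CommutativeRing R
  open CommutativeRing L
  open RingMorphisms.IsRingMonomorphism ι-mono
  open FieldFacts L isField
  open Lucas R p q using (u)
  open Binet R L ι isRingHomomorphism p q α β ι[p] ι[q]
  open Pow L using (_^_)
  open import Algebra.Properties.Group +-group using (x∙y⁻¹≈ε⇒x≈y)

  αᵈ≉βᵈ : ∀ d → d ≥ 1 → ¬ α ^ d - β ^ d ≈ 0#
  αᵈ≉βᵈ d d≥1 αᵈ-βᵈ≈0 with equal-powers⇒root-of-unity d d≥1 β≉0 (x∙y⁻¹≈ε⇒x≈y _ _ αᵈ-βᵈ≈0)
  ... | γ , βγ≈α , γ-root = α/β-not-root γ βγ≈α γ-root

  α-β≉0 : ¬ α - β ≈ 0#
  α-β≉0 α-β≈0 = αᵈ≉βᵈ 1 (s≤s ℕ.z≤n) (trans (sym (binet 1)) (trans (*-congˡ α-β≈0) (zeroʳ _)))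

  u-nonzero : ∀ d → d ≥ 1 → ¬ u d R.≈ R.0#
  u-nonzero d d≥1 u≈0 = αᵈ≉βᵈ d d≥1 (trans (sym (binet d)) (trans (*-congʳ (trans (⟦⟧-cong u≈0) 0#-homo)) (zeroˡ _)))

  binet-unique : (l : ℕ → R.Carrier) → (∀ n → n ≥ 1 → ι (l n) * (α - β) ≈ α ^ n - β ^ n) →
                 ∀ n → n ≥ 1 → l n R.≈ u n
  binet-unique l l-binet n n≥1 = injective (*-cancelʳ α-β≉0 (trans (l-binet n n≥1) (sym (binet n))))

theorem1p3 : ∀ {c ℓ c' ℓ' : Level}
    (R : CommutativeRing c ℓ) (L : CommutativeRing c' ℓ') →
    let module R = CommutativeRing R
        module L = CommutativeRing L
        module LP = Pow L
    in
    IsTranscendentalDedekind R →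
    IsField L →
    (ι : R.Carrier → L.Carrier) →
    IsRingEmbedding R L ι →
    (α β : L.Carrier) →
    ¬ (α L.≈ L.0#) →
    ¬ (β L.≈ L.0#) →
    IsAlgebraicOver R L ι α →
    IsAlgebraicOver R L ι β →
    (∀ γ → β L.* γ L.≈ α → ¬ IsRootOfUnity L γ) →
    (p q : R.Carrier) →
    ι p L.≈ α L.+ β →
    ι q L.≈ α L.* β →
    (∃[ x ] ∃[ y ] (x R.* p R.+ y R.* q R.≈ R.1#)) →
    ¬ (IsUnit R p × IsUnit R q) →
    (l : ℕ → R.Carrier) →
    (∀ n → n ≥ 1 → ι (l n) L.* (α L.- β) L.≈ (α LP.^ n) L.- (β LP.^ n)) →
    ∀ m n → m ≥ 1 → n ≥ 1 →
      IsGCD R (l m) (l n) (l (gcd m n))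
      × (∀ g → IsGCD R (l m) (l n) g → Associated R g (l (gcd m n)))
theorem1p3 R L ((domain , _) , _) isField ι ι-mono α β _ β≉0 _ _ α/β-not-root p q ι[p] ι[q] p⊥q _ l l-binet m n m≥1 n≥1 =
  l-gcd-isGCD , λ g g-isGCD → isGCD-associated domain l-gcd≉0 g-isGCD l-gcd-isGCD
  where
  open CommutativeRing R using (_≈_; 0#; sym; trans)
  open Divisibility R
  open Lucas R p q
  open LucasInField R L isField ι ι-mono α β β≉0 α/β-not-root p q ι[p] ι[q]

  d = gcd m n
  d≥1 : d ≥ 1
  d≥1 = ℕP.n≢0⇒n>0 (gcd[m,n]≢0 m n (inj₁ (ℕP.n>0⇒n≢0 m≥1)))

  l≈u : ∀ k → k ≥ 1 → l k ≈ u k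
  l≈u = binet-unique l l-binet

  l-gcd-isGCD : IsGCD R (l m) (l n) (l d)
  l-gcd-isGCD = bezoutGCD⇒isGCD (bezoutGCD-resp (sym (l≈u m m≥1)) (sym (l≈u n n≥1)) (sym (l≈u d d≥1))
                                                (u-strong-divisibility p⊥q m n))

  l-gcd≉0 : ¬ l d ≈ 0#
  l-gcd≉0 l-gcd≈0 = u-nonzero d d≥1 (trans (sym (l≈u d d≥1)) l-gcd≈0)
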